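{- Let $(V,\mathcal{C},I=[1,q],\sigma)$ be an instance and $k\in[1,q-1]$. Let $S\in\mathcal{S}_k\setminus\mathcal{B}_k$ be a non-base solution, let $T$ be the lex-min solution of $S$, and let $J=I_\sigma(T)$. Let $S'$ be a set with $S\subseteq S'\subsetneq T$. Write $V_{\langle J\rangle}\setminus S'=\{u_1,\dots,u_s\}$ with $u_1<\dots<u_s$. Then: (i) $T\in\mathcal{C}_{\max}(S'\cup\{u\};V_{\langle J\rangle})$ for every $u\in T\setminus S'$. (ii) Every component $C$ with $S'\subsetneq C\subseteq V_{\langle J\rangle}$ satisfies $I_\sigma(C)=J$. (iii) There is an index $j\in[1,s]$ with $\mathcal{C}_{\max}(S'\cup\{u_j\};V_{\langle J\rangle})\neq\emptyset$. Let $r$ be the smallest such index. Then $\mathcal{C}_{\max}(S'\cup\{u_j\};V_{\langle J\rangle})=\emptyset$ for each $j\in[1,r-1]$, and every component $C\in\mathcal{C}_{\max}(S'\cup\{u_r\};V_{\langle J\rangle})$ satisfies $I_\sigma(C)=J$. (iv) For this $r$, $T\cap\{u_j: j\in[1,r]\}=\{u_r\}$. (v) For this $r$, if $S'\cup\{u_r\}\in\mathcal{S}$, then $T=S'\cup\{u_r\}$.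
   Context: A set system $(V,\mathcal{C})$ consists of a finite totally ordered set $V$ and a family $\mathcal{C}\subseteq2^V$ of components. $\mathcal{C}_{\max}(Y)$ is the family of components $Z\subseteq Y$ such that no component $W$ satisfies $Z\subsetneq W\subseteq Y$. For $X\subseteq Y$, $\mathcal{C}_{\max}(X;Y)=\{C\in\mathcal{C}_{\max}(Y):X\subseteq C\}$. An instance is $(V,\mathcal{C},I,\sigma)$ with $I=[1,q]$ and $\sigma:V\to2^I$. Let $I_\sigma(X)=\bigcap_{v\in X}\sigma(v)$. A solution is a component $X$ such that every component $Y\supsetneq X$ has $I_\sigma(Y)\subsetneq I_\sigma(X)$; $\mathcal{S}$ is the family of solutions. For $i\in I$, $V_{\langle i\rangle}=\{v:i\in\sigma(v)\}$. For non-empty $J\subseteq I$, $V_{\langle J\rangle}=\{v:J\subseteq\sigma(v)\}$. $\min I_\sigma(X)$ is the least item of $I_\sigma(X)$, or $0$ if the set is empty. - $\mathcal{S}_k=\{X\in\mathcal{S}:\min I_\sigma(X)=k\}$; - $\mathcal{B}_k=\{X\in\mathcal{C}_{\max}(V_{\langle k\rangle}):\min I_\sigma(X)=k\}$. For subsets $J,K$ of a totally ordered set, $J\prec K$ means the minimum of the symmetric difference of $J$ and $K$ lies in $J$. For $X,Y\subseteq V$, $(I_\sigma(X),X)\preceq(I_\sigma(Y),Y)$ means one of the following: - $I_\sigma(X)\prec I_\sigma(Y)$; - $I_\sigma(X)=I_\sigma(Y)$ and $X\prec Y$; - $X=Y$. For $X$ with $\min I_\sigma(X)=k\in[1,q-1]$: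 - a superset solution of $X$ is a solution $T\in\mathcal{S}_k$ with $T\supsetneq X$; - it is minimal if no proper subset of it is a superset solution of $X$; - the lex-min solution of $X$ is the minimal superset solution $T$ with $(I_\sigma(T),T)\preceq(I_\sigma(T'),T')$ for every minimal superset solution $T'$ of $X$. -}

module Defs where

open import Data.Bool.Base using (Bool; true; false; if_then_else_)
open import Data.Nat.Base using (ℕ; zero; suc)
open import Data.Fin.Base using (Fin; toℕ)
open import Data.Fin.Properties using (all?)
open import Data.Fin.Subset using (Subset; ⁅_⁆; Side; inside; outside; _∈_; _⊆_; _⊂_)
open import Data.Fin.Subset.Properties using (_∈?_; _⊆?_)
open import Data.Vec.Base using (Vec; []; _∷_; tabulate)
open import Data.Product.Base using (_×_; Σ; ∃)
open import Data.Sum.Base using (_⊎_)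
open import Relation.Nullary using (¬_; does)
open import Relation.Nullary.Decidable using (_→-dec_)
open import Relation.Binary.PropositionalEquality using (_≡_)

-- V = Fin n (ordered by the order of Fin), items I = [1,q] encoded by Fin q
-- (item with index i : Fin q is the number toℕ i + 1).
-- A family of components is a predicate 𝒞 on Subset n.

Family : ℕ → Set₁
Family n = Subset n → Set

Iσ : ∀ {n q} → (Fin n → Subset q) → Subset n → Subset q
Iσ σ X = tabulate λ i →
  if does (all? (λ v → (v ∈? X) →-dec (i ∈? σ v))) then inside else outside

-- V_⟨J⟩ = { v : J ⊆ σ(v) }   (V_⟨k⟩ = V_⟨ ⁅ k ⁆ ⟩)
V⟨_⟩ : ∀ {n q} → Subset q → (Fin n → Subset q) → Subset n
V⟨ J ⟩ σ = tabulate λ v → if does (J ⊆? σ v) then inside else outside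

-- min J, as a number in [1,q], or 0 if J is empty
minI : ∀ {q} → Subset q → ℕ
minI [] = 0
minI (inside ∷ p) = 1
minI (outside ∷ p) with minI p
... | zero = 0
... | suc m = suc (suc m)

Cmax : ∀ {n} → Family n → Subset n → Subset n → Set
Cmax 𝒞 Y Z = 𝒞 Z × Z ⊆ Y × (∀ W → 𝒞 W → Z ⊂ W → ¬ (W ⊆ Y))

Cmax⟨_⟩ : ∀ {n} → Family n → Subset n → Subset n → Subset n → Set
Cmax⟨ 𝒞 ⟩ X Y C = Cmax 𝒞 Y C × X ⊆ C

Solution : ∀ {n q} → Family n → (Fin n → Subset q) → Subset n → Set
Solution 𝒞 σ X = 𝒞 X × (∀ Y → 𝒞 Y → X ⊂ Y → Iσ σ Y ⊂ Iσ σ X)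

-- 𝒮_k  (k given as a number in [1,q])
Sol_ : ∀ {n q} → ℕ → Family n → (Fin n → Subset q) → Subset n → Set
(Sol k) 𝒞 σ X = Solution 𝒞 σ X × minI (Iσ σ X) ≡ k

-- ℬ_k, where the item k is given by its index i : Fin q (k = toℕ i + 1)
Base : ∀ {n q} → Fin q → Family n → (Fin n → Subset q) → Subset n → Set
Base {q = q} i 𝒞 σ X =
  Cmax 𝒞 (V⟨ ⁅ i ⁆ ⟩ σ) X × minI (Iσ σ X) ≡ suc (toℕ i)

-- J ≺ K : the minimum of the symmetric difference lies in J
data _≺_ : ∀ {m} → Subset m → Subset m → Set where
  here  : ∀ {m} {xs ys : Subset m} → (inside ∷ xs) ≺ (outside ∷ ys)
  there : ∀ {m} {x} {xs ys : Subset m} → xs ≺ ys → (x ∷ xs) ≺ (x ∷ ys)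

Lex⪯ : ∀ {n q} → (Fin n → Subset q) → Subset n → Subset n → Set
Lex⪯ σ X Y = Iσ σ X ≺ Iσ σ Y ⊎ (Iσ σ X ≡ Iσ σ Y × X ≺ Y) ⊎ X ≡ Y

SupSol : ∀ {n q} → Family n → (Fin n → Subset q) → Subset n → Subset n → Set
SupSol 𝒞 σ X T = (Sol (minI (Iσ σ X))) 𝒞 σ T × X ⊂ T

MinSupSol : ∀ {n q} → Family n → (Fin n → Subset q) → Subset n → Subset n → Set
MinSupSol 𝒞 σ X T = SupSol 𝒞 σ X T × (∀ T′ → T′ ⊂ T → ¬ SupSol 𝒞 σ X T′)

LexMinSol : ∀ {n q} → Family n → (Fin n → Subset q) → Subset n → Subset n → Set
LexMinSol 𝒞 σ X T = MinSupSol 𝒞 σ X T × (∀ T′ → MinSupSol 𝒞 σ X T′ → Lex⪯ σ T T′)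

-- Lex-minimality of T is used only through one consequence: a superset
-- solution X of S with J = I_σ(T) ⊆ I_σ(X) has I_σ(X) = J. Indeed a minimal
-- superset solution below X has items K ⊇ I_σ(X), and K ⊋ J would give K ≺ J.
-- Hence every component C with S′ ⊊ C ⊆ V⟨J⟩ has items J (a maximal component
-- of V⟨I_σ(C)⟩ containing C is such a superset solution), and every maximal
-- component of V⟨J⟩ containing S′ ∪ {u}, u ∉ S′, is a minimal superset
-- solution. Comparing the one for u_r with T, the least element of their
-- difference lies in T and is some u_j; each of j < r, j = r, r < j then
-- contradicts u_r ∉ T.
module Submission where

open import Defs
open import Data.Nat.Base using (ℕ; suc) renaming (_≤_ to _≤ℕ_)
open import Data.Fin.Base using (Fin; toℕ; _<_; _≤_)
open import Data.Fin.Subset using (Subset; ⁅_⁆; _∈_; _∉_; _⊆_; _⊂_; _∪_; _─_)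
open import Data.Product.Base using (_×_; Σ; ∃; _,_)
open import Relation.Nullary using (¬_)
open import Relation.Unary using (Decidable)
open import Relation.Binary.PropositionalEquality using (_≡_)
open import Function.Bundles using (_⇔_)

open import Data.Nat.Base using (zero; s≤s)
open import Data.Bool.Base using (if_then_else_)
open import Data.Fin.Base using (zero; suc)
open import Data.Fin.Properties using (all?; _≟_; <-cmp; ≤-refl; ≤∧≢⇒<)
open import Data.Fin.Subset using (inside; outside; _⊈_; _⊃_)
open import Data.Fin.Subset.Properties
open import Data.Fin.Subset.Induction using (Acc; acc; ⊂-wellFounded; ⊃-wellFounded)
open import Data.Vec.Base using ([]; _∷_; tabulate; here; there)
open import Data.Vec.Properties using (lookup∘tabulate; []=⇒lookup; lookup⇒[]=)
open import Data.Product.Base using (proj₁; proj₂; map₂)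
open import Data.Sum.Base using (inj₁; inj₂; [_,_]′)
open import Data.Empty using (⊥; ⊥-elim)
open import Function.Base using (_∘_)
open import Function.Bundles using (Equivalence; mk⇔)
open import Relation.Nullary using (Dec; yes; no; does)
open import Relation.Nullary.Decidable using (_×-dec_; _→-dec_; decidable-stable; ¬¬-excluded-middle)
open import Relation.Nullary.Negation using (contradiction; ¬¬-map)
open import Relation.Binary.Definitions using (tri<; tri≈; tri>)
open import Relation.Binary.PropositionalEquality using (_≢_; refl; sym; trans; cong; subst; module ≡-Reasoning)

open Equivalence using (to; from)

∈-tabulate⇔ : ∀ {n} {P : Fin n → Set} (P? : Decidable P) {x} →
  x ∈ tabulate (λ y → if does (P? y) then inside else outside) ⇔ P x
∈-tabulate⇔ {P = P} P? {x} = mk⇔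
  (λ x∈ → sound (P? x) (trans (sym (lookup∘tabulate _ x)) ([]=⇒lookup x∈)))
  (λ p → lookup⇒[]= x _ (trans (lookup∘tabulate _ x) (complete (P? x) p)))
  where
  sound : (d : Dec (P x)) → (if does d then inside else outside) ≡ inside → P x
  sound (yes p) _ = p
  sound (no _) ()

  complete : (d : Dec (P x)) → P x → (if does d then inside else outside) ≡ inside
  complete (yes _) _ = refl
  complete (no ¬p) p = contradiction p ¬p

x∈p─q⇒x∉q : ∀ {n} {x : Fin n} {p q : Subset n} → x ∈ p ─ q → x ∉ q
x∈p─q⇒x∉q {p = _ ∷ p} {outside ∷ q} x∈ (there x∈q) = x∈p─q⇒x∉q (drop-there x∈) x∈q
x∈p─q⇒x∉q {p = _ ∷ p} {inside ∷ q} (there x∈) (there x∈q) = x∈p─q⇒x∉q x∈ x∈q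

⊆∧⊈⇒⊂ : ∀ {n} {p q : Subset n} → p ⊆ q → q ⊈ p → p ⊂ q
⊆∧⊈⇒⊂ {p = p} {q} p⊆q q⊈p with nonempty? (q ─ p)
... | yes (x , x∈q─p) = p⊆q , x , p─q⊆p q p x∈q─p , x∈p─q⇒x∉q x∈q─p
... | no q─p-empty = ⊥-elim (q⊈p q⊆p)
  where
  q⊆p : q ⊆ p
  q⊆p {x} x∈q = decidable-stable (x ∈? p) λ x∉p → q─p-empty (x , x∈p∧x∉q⇒x∈p─q x∈q x∉p)

p∪⁅x⁆⊆q : ∀ {n} {p q : Subset n} {x} → p ⊆ q → x ∈ q → p ∪ ⁅ x ⁆ ⊆ q
p∪⁅x⁆⊆q {p = p} {q} {x} p⊆q x∈q y∈ =
  [ p⊆q , (λ y∈⁅x⁆ → subst (_∈ q) (sym (x∈⁅y⁆⇒x≡y x y∈⁅x⁆)) x∈q) ]′ (x∈p∪q⁻ p ⁅ x ⁆ y∈)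

p⊂p∪⁅x⁆ : ∀ {n} {p : Subset n} {x} → x ∉ p → p ⊂ p ∪ ⁅ x ⁆
p⊂p∪⁅x⁆ {p = p} {x} x∉p = p⊆p∪q ⁅ x ⁆ , x , q⊆p∪q p ⁅ x ⁆ (x∈⁅x⁆ x) , x∉p

≺⇒⊈ : ∀ {m} {J K : Subset m} → J ≺ K → J ⊈ K
≺⇒⊈ here J⊆K with J⊆K here
... | ()
≺⇒⊈ (there J≺K) J⊆K = ≺⇒⊈ J≺K (drop-∷-⊆ J⊆K)

≺⇒least-difference : ∀ {m} {X Y : Subset m} → X ≺ Y →
  ∃ λ x → x ∈ X × x ∉ Y × (∀ y → y < x → y ∈ Y → y ∈ X)
≺⇒least-difference here = zero , here , (λ ()) , λ _ ()
≺⇒least-difference (there X≺Y) with ≺⇒least-difference X≺Y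
... | x , x∈X , x∉Y , below = suc x , there x∈X , x∉Y ∘ drop-there , below′
  where
  below′ : ∀ y → y < suc x → y ∈ _ → y ∈ _
  below′ zero _ here = here
  below′ (suc y) (s≤s y<x) (there y∈Y) = there (below y y<x y∈Y)

shift : ℕ → ℕ
shift zero = zero
shift (suc m) = suc (suc m)

minI-outside : ∀ {q} (J : Subset q) → minI (outside ∷ J) ≡ shift (minI J)
minI-outside J with minI J
... | zero = refl
... | suc _ = refl

shift-injective : ∀ {a b} → shift a ≡ shift b → a ≡ b
shift-injective {zero} {zero} _ = refl
shift-injective {suc a} {suc b} refl = refl

shift≢1 : ∀ a → shift a ≢ 1
shift≢1 zero ()
shift≢1 (suc a) ()

minI-sandwich : ∀ {q} {J K L : Subset q} → J ⊆ K → K ⊆ L → minI J ≡ minI L → minI K ≡ minI L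
minI-sandwich {J = []} {[]} {[]} _ _ _ = refl
minI-sandwich {J = inside ∷ _} {inside ∷ _} {inside ∷ _} _ _ _ = refl
minI-sandwich {J = inside ∷ _} {outside ∷ _} J⊆K _ _ with J⊆K here
... | ()
minI-sandwich {J = inside ∷ _} {inside ∷ _} {outside ∷ _} _ K⊆L _ with K⊆L here
... | ()
minI-sandwich {J = outside ∷ J} {L = inside ∷ _} _ _ eq =
  contradiction (trans (sym (minI-outside J)) eq) (shift≢1 (minI J))
minI-sandwich {J = outside ∷ _} {inside ∷ _} {outside ∷ _} _ K⊆L _ with K⊆L here
... | ()
minI-sandwich {J = outside ∷ J} {outside ∷ K} {outside ∷ L} J⊆K K⊆L eq = begin
  minI (outside ∷ K)  ≡⟨ minI-outside K ⟩
  shift (minI K)      ≡⟨ cong shift (minI-sandwich (drop-∷-⊆ J⊆K) (drop-∷-⊆ K⊆L) minI-J≡minI-L) ⟩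
  shift (minI L)      ≡⟨ sym (minI-outside L) ⟩
  minI (outside ∷ L)  ∎
  where
  open ≡-Reasoning
  minI-J≡minI-L : minI J ≡ minI L
  minI-J≡minI-L = shift-injective (trans (sym (minI-outside J)) (trans eq (minI-outside L)))

least-index : ∀ {s} {P : Fin s → Set} → Decidable P → ∃ P →
  ∃ λ r → P r × (∀ j → j < r → ¬ P j)
least-index {suc s} P? (j , Pj) with P? zero
... | yes P0 = zero , P0 , λ _ ()
... | no ¬P0 with j
...   | zero = contradiction Pj ¬P0
...   | suc j′ with least-index (P? ∘ suc) (j′ , Pj)
...     | r , Pr , below = suc r , Pr , below′
  where
  below′ : ∀ j → j < suc r → ¬ _
  below′ zero _ = ¬P0
  below′ (suc j) (s≤s j<r) = below j j<r

¬¬-minimal⊆ : ∀ {n} (P : Subset n → Set) {X} → P X →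
  ¬ ¬ (∃ λ Y → Y ⊆ X × P Y × (∀ Z → Z ⊂ Y → ¬ P Z))
¬¬-minimal⊆ P {X} PX = go (⊂-wellFounded X) PX
  where
  go : ∀ {X} → Acc _⊂_ X → P X → ¬ ¬ (∃ λ Y → Y ⊆ X × P Y × (∀ Z → Z ⊂ Y → ¬ P Z))
  go {X} (acc smaller) PX ¬minimal = ¬¬-excluded-middle {A = ∃ λ Y → Y ⊂ X × P Y} λ where
    (yes (Y , Y⊂X , PY)) → go (smaller Y⊂X) PY λ (Z , Z⊆Y , minimalZ) →
      ¬minimal (Z , ⊆-trans Z⊆Y (proj₁ Y⊂X) , minimalZ)
    (no ∄Y) → ¬minimal (X , ⊆-refl , PX , λ Y Y⊂X PY → ∄Y (Y , Y⊂X , PY))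

module _ {n : ℕ} {𝒞 : Family n} (𝒞? : Decidable 𝒞) where

  Cmax? : ∀ Y → Decidable (Cmax 𝒞 Y)
  Cmax? Y Z = 𝒞? Z ×-dec Z ⊆? Y ×-dec maximal?
    where
    maximal? : Dec (∀ W → 𝒞 W → Z ⊂ W → ¬ W ⊆ Y)
    maximal? with anySubset? (λ W → 𝒞? W ×-dec Z ⊂? W ×-dec W ⊆? Y)
    ... | yes (W , 𝒞W , Z⊂W , W⊆Y) = no λ maximal → maximal W 𝒞W Z⊂W W⊆Y
    ... | no ∄W = yes λ W 𝒞W Z⊂W W⊆Y → ∄W (W , 𝒞W , Z⊂W , W⊆Y)

  Cmax-extension : ∀ {X Y} → 𝒞 X → X ⊆ Y → ∃ λ C → Cmax 𝒞 Y C × X ⊆ C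
  Cmax-extension {X} = go (⊃-wellFounded X)
    where
    go : ∀ {X Y} → Acc _⊃_ X → 𝒞 X → X ⊆ Y → ∃ λ C → Cmax 𝒞 Y C × X ⊆ C
    go {X} {Y} (acc larger) 𝒞X X⊆Y with anySubset? (λ W → 𝒞? W ×-dec X ⊂? W ×-dec W ⊆? Y)
    ... | yes (W , 𝒞W , X⊂W , W⊆Y) = map₂ (map₂ (⊆-trans (proj₁ X⊂W))) (go (larger X⊂W) 𝒞W W⊆Y)
    ... | no ∄W = X , (𝒞X , X⊆Y , λ W 𝒞W X⊂W W⊆Y → ∄W (W , 𝒞W , X⊂W , W⊆Y)) , ⊆-refl

module Galois {n q : ℕ} (σ : Fin n → Subset q) where

  ∈-Iσ : ∀ {X i} → i ∈ Iσ σ X ⇔ (∀ v → v ∈ X → i ∈ σ v)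
  ∈-Iσ {X} = ∈-tabulate⇔ (λ i → all? (λ v → (v ∈? X) →-dec (i ∈? σ v)))

  ∈-V⟨⟩ : ∀ {K v} → v ∈ V⟨ K ⟩ σ ⇔ K ⊆ σ v
  ∈-V⟨⟩ {K} = ∈-tabulate⇔ (λ v → K ⊆? σ v)

  ⊆V⟨⟩⇒⊆Iσ : ∀ {K X} → X ⊆ V⟨ K ⟩ σ → K ⊆ Iσ σ X
  ⊆V⟨⟩⇒⊆Iσ X⊆V i∈K = from ∈-Iσ λ _ v∈X → to ∈-V⟨⟩ (X⊆V v∈X) i∈K

  ⊆Iσ⇒⊆V⟨⟩ : ∀ {K X} → K ⊆ Iσ σ X → X ⊆ V⟨ K ⟩ σ
  ⊆Iσ⇒⊆V⟨⟩ K⊆I v∈X = from ∈-V⟨⟩ λ i∈K → to ∈-Iσ (K⊆I i∈K) _ v∈X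

  ⊆V⟨Iσ⟩ : ∀ {X} → X ⊆ V⟨ Iσ σ X ⟩ σ
  ⊆V⟨Iσ⟩ = ⊆Iσ⇒⊆V⟨⟩ ⊆-refl

  Iσ-antitone : ∀ {X Y} → X ⊆ Y → Iσ σ Y ⊆ Iσ σ X
  Iσ-antitone X⊆Y = ⊆V⟨⟩⇒⊆Iσ (⊆-trans X⊆Y ⊆V⟨Iσ⟩)

module Solutions {n q : ℕ} (𝒞 : Family n) (σ : Fin n → Subset q) where

  open Galois σ public

  Cmax-V⟨⟩⇒Solution : ∀ {K X} → Cmax 𝒞 (V⟨ K ⟩ σ) X → Solution 𝒞 σ X
  Cmax-V⟨⟩⇒Solution {K} (𝒞X , X⊆V , maximal) = 𝒞X , λ Y 𝒞Y X⊂Y →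
    ⊆∧⊈⇒⊂ (Iσ-antitone (proj₁ X⊂Y)) λ IX⊆IY →
      maximal Y 𝒞Y X⊂Y (⊆Iσ⇒⊆V⟨⟩ (⊆-trans (⊆V⟨⟩⇒⊆Iσ {K} X⊆V) IX⊆IY))

  Solution⇒Cmax : ∀ {X} → Solution 𝒞 σ X → Cmax 𝒞 (V⟨ Iσ σ X ⟩ σ) X
  Solution⇒Cmax (𝒞X , isSolution) = 𝒞X , ⊆V⟨Iσ⟩ , λ W 𝒞W X⊂W W⊆V →
    ⊂-irref refl (⊂-⊆-trans (isSolution W 𝒞W X⊂W) (⊆V⟨⟩⇒⊆Iσ W⊆V))

module LexMin {n q : ℕ} (𝒞 : Family n) (σ : Fin n → Subset q)
  {S T : Subset n} (lexMin : LexMinSol 𝒞 σ S T) where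

  open Solutions 𝒞 σ public

  J : Subset q
  J = Iσ σ T

  T-minimal : MinSupSol 𝒞 σ S T
  T-minimal = proj₁ lexMin

  T-solution : Solution 𝒞 σ T
  T-solution = proj₁ (proj₁ (proj₁ T-minimal))

  minI-J : minI J ≡ minI (Iσ σ S)
  minI-J = proj₂ (proj₁ (proj₁ T-minimal))

  MinSupSol-Iσ : ∀ {X} → MinSupSol 𝒞 σ S X → J ⊆ Iσ σ X → Iσ σ X ≡ J
  MinSupSol-Iσ minX J⊆IX with proj₂ lexMin _ minX
  ... | inj₁ J≺IX = ⊥-elim (≺⇒⊈ J≺IX J⊆IX)
  ... | inj₂ (inj₁ (J≡IX , _)) = sym J≡IX
  ... | inj₂ (inj₂ refl) = refl

  SupSol-Iσ : ∀ {X} → SupSol 𝒞 σ S X → J ⊆ Iσ σ X → Iσ σ X ≡ J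
  SupSol-Iσ {X} supX J⊆IX =
    ⊆-antisym (decidable-stable (Iσ σ X ⊆? J) (¬¬-map IX⊆J (¬¬-minimal⊆ (SupSol 𝒞 σ S) supX))) J⊆IX
    where
    IX⊆J : (∃ λ Y → Y ⊆ X × MinSupSol 𝒞 σ S Y) → Iσ σ X ⊆ J
    IX⊆J (Y , Y⊆X , minY) = ⊆-trans (Iσ-antitone Y⊆X)
      (⊆-reflexive (MinSupSol-Iσ minY (⊆-trans J⊆IX (Iσ-antitone Y⊆X))))

  SupSol-intro : ∀ {X} → Solution 𝒞 σ X → J ⊆ Iσ σ X → S ⊂ X → SupSol 𝒞 σ S X
  SupSol-intro solX J⊆IX S⊂X =
    (solX , minI-sandwich J⊆IX (Iσ-antitone (proj₁ S⊂X)) minI-J) , S⊂X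

module Between {n q : ℕ} {𝒞 : Family n} (𝒞? : Decidable 𝒞) (σ : Fin n → Subset q)
  {S T : Subset n} (lexMin : LexMinSol 𝒞 σ S T)
  {S′ : Subset n} (S⊆S′ : S ⊆ S′) (S′⊂T : S′ ⊂ T) where

  open LexMin 𝒞 σ lexMin public

  T⊆V⟨J⟩ : T ⊆ V⟨ J ⟩ σ
  T⊆V⟨J⟩ = ⊆V⟨Iσ⟩

  T-Cmax⟨⟩ : ∀ {w} → w ∈ T → Cmax⟨ 𝒞 ⟩ (S′ ∪ ⁅ w ⁆) (V⟨ J ⟩ σ) T
  T-Cmax⟨⟩ w∈T = Solution⇒Cmax T-solution , p∪⁅x⁆⊆q (proj₁ S′⊂T) w∈T

  Iσ-above-S′ : ∀ C → 𝒞 C → S′ ⊂ C → C ⊆ V⟨ J ⟩ σ → Iσ σ C ≡ J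
  Iσ-above-S′ C 𝒞C S′⊂C C⊆V with Cmax-extension 𝒞? 𝒞C (⊆V⟨Iσ⟩ {C})
  ... | C* , C*-max , C⊆C* = trans (sym IC*≡IC) (SupSol-Iσ supC* J⊆IC*)
    where
    IC*≡IC : Iσ σ C* ≡ Iσ σ C
    IC*≡IC = ⊆-antisym (Iσ-antitone C⊆C*) (⊆V⟨⟩⇒⊆Iσ (proj₁ (proj₂ C*-max)))

    J⊆IC* : J ⊆ Iσ σ C*
    J⊆IC* = ⊆-trans (⊆V⟨⟩⇒⊆Iσ C⊆V) (⊆-reflexive (sym IC*≡IC))

    supC* : SupSol 𝒞 σ S C*
    supC* = SupSol-intro (Cmax-V⟨⟩⇒Solution {Iσ σ C} C*-max) J⊆IC* (⊆-⊂-trans S⊆S′ (⊂-⊆-trans S′⊂C C⊆C*))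

  Iσ-Cmax⟨⟩ : ∀ {w C} → w ∉ S′ → Cmax⟨ 𝒞 ⟩ (S′ ∪ ⁅ w ⁆) (V⟨ J ⟩ σ) C → Iσ σ C ≡ J
  Iσ-Cmax⟨⟩ w∉S′ ((𝒞C , C⊆V , _) , S′w⊆C) =
    Iσ-above-S′ _ 𝒞C (⊂-⊆-trans (p⊂p∪⁅x⁆ w∉S′) S′w⊆C) C⊆V

  Cmax⟨⟩⇒MinSupSol : ∀ {w C} → w ∉ S′ → Cmax⟨ 𝒞 ⟩ (S′ ∪ ⁅ w ⁆) (V⟨ J ⟩ σ) C → MinSupSol 𝒞 σ S C
  Cmax⟨⟩⇒MinSupSol {C = C} w∉S′ C-max⟨⟩@(C-max@(𝒞C , _) , S′w⊆C) = supC , minimal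
    where
    IC≡J : Iσ σ C ≡ J
    IC≡J = Iσ-Cmax⟨⟩ w∉S′ C-max⟨⟩

    supC : SupSol 𝒞 σ S C
    supC = SupSol-intro (Cmax-V⟨⟩⇒Solution {J} C-max) (⊆-reflexive (sym IC≡J))
      (⊆-⊂-trans S⊆S′ (⊂-⊆-trans (p⊂p∪⁅x⁆ w∉S′) S′w⊆C))

    minimal : ∀ T′ → T′ ⊂ C → ¬ SupSol 𝒞 σ S T′
    minimal T′ T′⊂C supT′ = ⊂-irref IC≡IT′ (proj₂ (proj₁ (proj₁ supT′)) C 𝒞C T′⊂C)
      where
      IC≡IT′ : Iσ σ C ≡ Iσ σ T′
      IC≡IT′ = trans IC≡J (sym (SupSol-Iσ supT′
        (⊆-trans (⊆-reflexive (sym IC≡J)) (Iσ-antitone (proj₁ T′⊂C)))))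

module Enumeration {n q : ℕ} {𝒞 : Family n} (𝒞? : Decidable 𝒞) (σ : Fin n → Subset q)
  {S T : Subset n} (lexMin : LexMinSol 𝒞 σ S T)
  {S′ : Subset n} (S⊆S′ : S ⊆ S′) (S′⊂T : S′ ⊂ T)
  {s : ℕ} (u : Fin s → Fin n) (u-increasing : ∀ a b → a < b → u a < u b)
  (u-enumerates : ∀ v → v ∈ (V⟨ Iσ σ T ⟩ σ ─ S′) ⇔ ∃ λ j → u j ≡ v) where

  open Between 𝒞? σ lexMin S⊆S′ S′⊂T public

  u∉S′ : ∀ j → u j ∉ S′
  u∉S′ j = x∈p─q⇒x∉q (from (u-enumerates (u j)) (j , refl))

  T─S′-enumerated : ∀ {v} → v ∈ T → v ∉ S′ → ∃ λ j → u j ≡ v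
  T─S′-enumerated {v} v∈T v∉S′ = to (u-enumerates v) (x∈p∧x∉q⇒x∈p─q (T⊆V⟨J⟩ v∈T) v∉S′)

  HasCmax : Fin s → Set
  HasCmax j = ∃ λ C → Cmax⟨ 𝒞 ⟩ (S′ ∪ ⁅ u j ⁆) (V⟨ J ⟩ σ) C

  HasCmax? : Decidable HasCmax
  HasCmax? j = anySubset? λ C → Cmax? 𝒞? (V⟨ J ⟩ σ) C ×-dec (S′ ∪ ⁅ u j ⁆ ⊆? C)

  first : ∃ λ r → HasCmax r × (∀ j → j < r → ¬ HasCmax j)
  first with proj₂ S′⊂T
  ... | w , w∈T , w∉S′ with T─S′-enumerated w∈T w∉S′
  ...   | j , refl = least-index HasCmax? (j , T , T-Cmax⟨⟩ w∈T)

  r : Fin s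
  r = proj₁ first

  r-HasCmax : HasCmax r
  r-HasCmax = proj₁ (proj₂ first)

  before-r : ∀ j → j < r → ¬ HasCmax j
  before-r = proj₂ (proj₂ first)

  u<r∉T : ∀ {j} → j < r → u j ∉ T
  u<r∉T j<r u∈T = before-r _ j<r (T , T-Cmax⟨⟩ u∈T)

  u-r∈T : u r ∈ T
  u-r∈T = decidable-stable (u r ∈? T) λ u-r∉T →
    T⋠C u-r∉T (proj₂ lexMin C (Cmax⟨⟩⇒MinSupSol (u∉S′ r) C-max⟨⟩))
    where
    C : Subset n
    C = proj₁ r-HasCmax

    C-max⟨⟩ : Cmax⟨ 𝒞 ⟩ (S′ ∪ ⁅ u r ⁆) (V⟨ J ⟩ σ) C
    C-max⟨⟩ = proj₂ r-HasCmax

    u-r∈C : u r ∈ C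
    u-r∈C = proj₂ C-max⟨⟩ (q⊆p∪q S′ ⁅ u r ⁆ (x∈⁅x⁆ (u r)))

    T⋠C : u r ∉ T → Lex⪯ σ T C → ⊥
    T⋠C _ (inj₁ J≺IC) = ≺⇒⊈ J≺IC (⊆-reflexive (sym (Iσ-Cmax⟨⟩ (u∉S′ r) C-max⟨⟩)))
    T⋠C u-r∉T (inj₂ (inj₂ T≡C)) = u-r∉T (subst (u r ∈_) (sym T≡C) u-r∈C)
    T⋠C u-r∉T (inj₂ (inj₁ (_ , T≺C))) with ≺⇒least-difference T≺C
    ... | m , m∈T , m∉C , below with T─S′-enumerated m∈T (m∉C ∘ proj₂ C-max⟨⟩ ∘ p⊆p∪q ⁅ u r ⁆)
    ...   | j , refl with <-cmp r j
    ...     | tri< r<j _ _ = u-r∉T (below (u r) (u-increasing r j r<j) u-r∈C)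
    ...     | tri≈ _ refl _ = u-r∉T m∈T
    ...     | tri> _ _ j<r = u<r∉T j<r m∈T

  T∩u≤r : ∀ v → (v ∈ T × ∃ λ j → j ≤ r × u j ≡ v) ⇔ v ≡ u r
  T∩u≤r v = mk⇔ only-u-r (λ { refl → u-r∈T , r , ≤-refl , refl })
    where
    only-u-r : (v ∈ T × ∃ λ j → j ≤ r × u j ≡ v) → v ≡ u r
    only-u-r (v∈T , j , j≤r , refl) with j ≟ r
    ... | yes j≡r = cong u j≡r
    ... | no j≢r = contradiction v∈T (u<r∉T (≤∧≢⇒< j≤r j≢r))

  T≡S′∪u-r : Solution 𝒞 σ (S′ ∪ ⁅ u r ⁆) → T ≡ S′ ∪ ⁅ u r ⁆
  T≡S′∪u-r solX = ⊆-antisym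
    (decidable-stable (T ⊆? S′ ∪ ⁅ u r ⁆) λ T⊈X → proj₂ T-minimal _ (⊆∧⊈⇒⊂ X⊆T T⊈X) supX) X⊆T
    where
    X⊆T : S′ ∪ ⁅ u r ⁆ ⊆ T
    X⊆T = proj₂ (T-Cmax⟨⟩ u-r∈T)

    supX : SupSol 𝒞 σ S (S′ ∪ ⁅ u r ⁆)
    supX = SupSol-intro solX (Iσ-antitone X⊆T) (⊆-⊂-trans S⊆S′ (p⊂p∪⁅x⁆ (u∉S′ r)))

lemma4 : ∀ {n q : ℕ} (𝒞 : Family n) → Decidable 𝒞 → (σ : Fin n → Subset q)
    → (k : Fin q) → suc (suc (toℕ k)) ≤ℕ q
    → (S : Subset n) → (Sol (suc (toℕ k))) 𝒞 σ S → ¬ Base k 𝒞 σ S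
    → (T : Subset n) → LexMinSol 𝒞 σ S T
    → (S′ : Subset n) → S ⊆ S′ → S′ ⊂ T
    → (s : ℕ) (u : Fin s → Fin n)
    → (∀ a b → a < b → u a < u b)
    → (∀ v → v ∈ (V⟨ Iσ σ T ⟩ σ ─ S′) ⇔ ∃ λ j → u j ≡ v)
    → (∀ w → w ∈ T → w ∉ S′ → Cmax⟨ 𝒞 ⟩ (S′ ∪ ⁅ w ⁆) (V⟨ Iσ σ T ⟩ σ) T)
      × (∀ C → 𝒞 C → S′ ⊂ C → C ⊆ V⟨ Iσ σ T ⟩ σ → Iσ σ C ≡ Iσ σ T)
      × Σ (Fin s) λ r →
          (∃ λ C → Cmax⟨ 𝒞 ⟩ (S′ ∪ ⁅ u r ⁆) (V⟨ Iσ σ T ⟩ σ) C)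
          × (∀ j → j < r → ∀ C → ¬ Cmax⟨ 𝒞 ⟩ (S′ ∪ ⁅ u j ⁆) (V⟨ Iσ σ T ⟩ σ) C)
          × (∀ C → Cmax⟨ 𝒞 ⟩ (S′ ∪ ⁅ u r ⁆) (V⟨ Iσ σ T ⟩ σ) C → Iσ σ C ≡ Iσ σ T)
          × (∀ v → (v ∈ T × ∃ λ j → j ≤ r × u j ≡ v) ⇔ v ≡ u r)
          × (Solution 𝒞 σ (S′ ∪ ⁅ u r ⁆) → T ≡ S′ ∪ ⁅ u r ⁆)
lemma4 𝒞 𝒞? σ _ _ S _ _ T lexMin S′ S⊆S′ S′⊂T s u u-increasing u-enumerates =
    (λ _ w∈T _ → T-Cmax⟨⟩ w∈T)
  , Iσ-above-S′
  , r
  , r-HasCmax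
  , (λ j j<r C C-max⟨⟩ → before-r j j<r (C , C-max⟨⟩))
  , (λ _ → Iσ-Cmax⟨⟩ (u∉S′ r))
  , T∩u≤r
  , T≡S′∪u-r
  where open Enumeration 𝒞? σ lexMin S⊆S′ S′⊂T u u-increasing u-enumerates
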